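{- If a graph $G$ has a successive clique-cover, then $G$ is $\alpha$-excellent.
   Context: All graphs are finite and simple. A graph is $\alpha$-excellent if every vertex is contained in some maximum independent set. A vertex is simplicial if its neighbors are pairwise adjacent; a simplex of a graph is a maximal complete subgraph containing at least one simplicial vertex of that graph. An ordered sequence $(V_1,\ldots,V_n)$ of subsets of $V(G)$ is a successive clique-cover of $G$ if: (a) $V_1,\ldots,V_n$ form a partition of $V(G)$; (b) for each $i\in\{1,\ldots,n\}$, $G[V_i]$ is a simplex of $G-\bigcup_{j<i}V_j$; (c) for each $i\in\{1,\ldots,n-1\}$ and every $u_i\in V_i$ there are vertices $u_{i+1}\in V_{i+1},\ldots,u_n\in V_n$ such that $\{u_i,u_{i+1},\ldots,u_n\}$ is independent. -}

module Defs where

open import Data.Nat using (ℕ; _≤_)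
open import Data.Fin using (Fin; _<_)
open import Data.Fin.Subset using (Subset; _∈_; _∉_; _⊆_; ∣_∣)
open import Data.Bool using (Bool; true; false)
open import Data.Product using (Σ; ∃; _×_; _,_)
open import Relation.Binary.PropositionalEquality using (_≡_; _≢_)
open import Relation.Nullary using (¬_)

record Graph : Set where
  field
    n     : ℕ
    adj   : Fin n → Fin n → Bool
    irrefl : ∀ x → adj x x ≡ false
    sym   : ∀ x y → adj x y ≡ adj y x

module _ (G : Graph) where
  open Graph G

  V : Set
  V = Fin n

  Adj : V → V → Set
  Adj x y = adj x y ≡ true

  Independent : Subset n → Set
  Independent I = ∀ x y → x ∈ I → y ∈ I → ¬ Adj x y

  MaximumIndependent : Subset n → Set
  MaximumIndependent I = Independent I × (∀ J → Independent J → ∣ J ∣ ≤ ∣ I ∣)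

  AlphaExcellent : Set
  AlphaExcellent = ∀ v → ∃ λ I → MaximumIndependent I × v ∈ I

  CliqueIn : Subset n → Subset n → Set
  CliqueIn S C = C ⊆ S × (∀ x y → x ∈ C → y ∈ C → x ≢ y → Adj x y)

  MaximalCliqueIn : Subset n → Subset n → Set
  MaximalCliqueIn S C = CliqueIn S C × (∀ D → CliqueIn S D → C ⊆ D → D ⊆ C)

  SimplicialIn : Subset n → V → Set
  SimplicialIn S v = v ∈ S ×
    (∀ x y → x ∈ S → y ∈ S → Adj v x → Adj v y → x ≢ y → Adj x y)

  SimplexIn : Subset n → Subset n → Set
  SimplexIn S C = MaximalCliqueIn S C × (∃ λ v → v ∈ C × SimplicialIn S v)

  -- the sequence of parts (V₁,…,V_k) is indexed by Fin k
  -- vertices remaining after deleting V_j for all j < i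
  Remaining : {k : ℕ} → (Fin k → Subset n) → Fin k → V → Set
  Remaining Vs i x = ∀ j → j < i → x ∉ Vs j

  record SuccessiveCliqueCover {k : ℕ} (Vs : Fin k → Subset n) : Set where
    field
      cover    : ∀ x → ∃ λ i → x ∈ Vs i
      disjoint : ∀ x i j → x ∈ Vs i → x ∈ Vs j → i ≡ j
      -- (b) G[V_i] is a simplex of G - ⋃_{j<i} V_j
      simplex  : ∀ i → (S : Subset n) → (∀ x → x ∈ S → Remaining Vs i x)
                   → (∀ x → Remaining Vs i x → x ∈ S) → SimplexIn S (Vs i)
      -- (c) every u ∈ V_i extends to an independent transversal u, u_{i+1}, …, u_k
      extend   : ∀ i u → u ∈ Vs i → Σ (Fin k → V) λ f →
                   (∀ j → i < j → f j ∈ Vs j) ×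
                   (∀ j → i < j → ¬ Adj u (f j)) ×
                   (∀ j j' → i < j → i < j' → ¬ Adj (f j) (f j'))

  HasSuccessiveCliqueCover : Set
  HasSuccessiveCliqueCover = ∃ λ k → Σ (Fin k → Subset n) SuccessiveCliqueCover

{-# OPTIONS --safe #-}
-- Each part Vᵢ is a clique, so an independent set meets every part at most once and
-- α(G) ≤ k. Conversely, a simplicial vertex sᵢ of the simplex Vᵢ has no neighbour w in a
-- later part: every vertex of Vᵢ would be adjacent to w, so Vᵢ ∪ {w} would be a larger
-- clique of G - ⋃_{j<i} Vⱼ. Hence for u ∈ Vᵢ the vertices s₁,…,sᵢ₋₁, u, u_{i+1},…,u_k
-- (the last ones from condition (c)) form an independent set of size k containing u.
module Submission where

open import Defs
open import Data.Bool using (true; false)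
open import Data.Fin as Fin using (Fin; zero; suc; _<_)
open import Data.Fin.Properties using (_≟_; _≤?_; <-cmp; <-irrefl; <-trans; suc-injective; 0≢1+n)
open import Data.Fin.Subset using (Subset; _∈_; _⊆_; _∪_; ⁅_⁆; ⊤; _-_; ∣_∣)
open import Data.Fin.Subset.Properties
  using (∈⊤; ∣⊤∣≡n; x∈⁅x⁆; x∈⁅y⁆⇒x≡y; x∈p∪q⁻; p⊆p∪q; q⊆p∪q; x∈p∧x≢y⇒x∈p-y; x∈p⇒∣p-x∣<∣p∣)
open import Data.Nat using (ℕ; _≤_; z≤n; s≤s)
open import Data.Nat.Properties using (≤-trans; ≤-reflexive; ≮⇒≥; <⇒≤; <-≤-trans)
open import Data.Product using (_×_; _,_; proj₁; proj₂)
open import Data.Sum using (inj₁; inj₂)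
open import Data.Vec using (_∷_; []; here; there; tabulate)
open import Data.Vec.Properties using (lookup∘tabulate; []=⇒lookup; lookup⇒[]=)
open import Function using (_∘_)
open import Level using (Level)
open import Relation.Binary.Definitions using (tri<; tri≈; tri>)
open import Relation.Binary.PropositionalEquality
  using (_≡_; _≢_; refl; sym; trans; cong; subst; subst₂)
open import Relation.Nullary using (¬_; yes; no; does; contradiction)
open import Relation.Nullary.Decidable using (dec-true)
open import Relation.Unary using (Pred; Decidable)

module _ {n : ℕ} {ℓ : Level} {P : Pred (Fin n) ℓ} (P? : Decidable P) where

  subsetOf : Subset n
  subsetOf = tabulate (does ∘ P?)

  ∈-subsetOf⁺ : ∀ {x} → P x → x ∈ subsetOf
  ∈-subsetOf⁺ {x} px = lookup⇒[]= x _ (trans (lookup∘tabulate _ x) (dec-true (P? x) px))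

  ∈-subsetOf⁻ : ∀ {x} → x ∈ subsetOf → P x
  ∈-subsetOf⁻ {x} x∈ with P? x | trans (sym (lookup∘tabulate _ x)) ([]=⇒lookup x∈)
  ... | yes px | _ = px
  ... | no _   | ()

∣p∣≤∣q∣-injection : ∀ {m n} {p : Subset m} {q : Subset n} (f : Fin m → Fin n) →
  (∀ {x} → x ∈ p → f x ∈ q) → (∀ {x y} → x ∈ p → y ∈ p → f x ≡ f y → x ≡ y) →
  ∣ p ∣ ≤ ∣ q ∣
∣p∣≤∣q∣-injection {p = []} f into inj = z≤n
∣p∣≤∣q∣-injection {p = false ∷ p} f into inj =
  ∣p∣≤∣q∣-injection (f ∘ suc) (into ∘ there) (λ x∈ y∈ → suc-injective ∘ inj (there x∈) (there y∈))
∣p∣≤∣q∣-injection {p = true ∷ p} {q} f into inj =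
  ≤-trans (s≤s (∣p∣≤∣q∣-injection (f ∘ suc) into-rest inj-rest)) (x∈p⇒∣p-x∣<∣p∣ (into here))
  where
  into-rest : ∀ {x} → x ∈ p → f (suc x) ∈ q - f zero
  into-rest x∈ = x∈p∧x≢y⇒x∈p-y (into (there x∈)) (0≢1+n ∘ inj here (there x∈) ∘ sym)

  inj-rest : ∀ {x y} → x ∈ p → y ∈ p → f (suc x) ≡ f (suc y) → x ≡ y
  inj-rest x∈ y∈ = suc-injective ∘ inj (there x∈) (there y∈)

module _ (G : Graph) where
  open Graph G using (n; irrefl)

  Adj-sym : ∀ {x y} → Adj G x y → Adj G y x
  Adj-sym {x} {y} = trans (Graph.sym G y x)

  Adj-irrefl : ∀ x → ¬ Adj G x x
  Adj-irrefl x xx with () ← trans (sym (irrefl x)) xx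

  <-nonadjacent⇒nonadjacent : ∀ {k} (h : Fin k → V G) →
    (∀ {a b} → a < b → ¬ Adj G (h a) (h b)) → ∀ a b → ¬ Adj G (h a) (h b)
  <-nonadjacent⇒nonadjacent h nonadj a b with <-cmp a b
  ... | tri< a<b _ _ = nonadj a<b
  ... | tri≈ _ refl _ = Adj-irrefl (h a)
  ... | tri> _ _ b<a = nonadj b<a ∘ Adj-sym

  clique∩independent⇒≡ : ∀ {S C J x y} → CliqueIn G S C → Independent G J →
    x ∈ C → y ∈ C → x ∈ J → y ∈ J → x ≡ y
  clique∩independent⇒≡ {x = x} {y} (_ , clique) indep x∈C y∈C x∈J y∈J with x ≟ y
  ... | yes x≡y = x≡y
  ... | no x≢y = contradiction (clique x y x∈C y∈C x≢y) (indep x y x∈J y∈J)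

  clique-∪-⁅⁆ : ∀ {S C w} → CliqueIn G S C → w ∈ S →
    (∀ {x} → x ∈ C → x ≢ w → Adj G x w) → CliqueIn G S (C ∪ ⁅ w ⁆)
  clique-∪-⁅⁆ {S} {C} {w} (C⊆S , clique) w∈S adj-w = ⊆S , adjacent
    where
    ⊆S : C ∪ ⁅ w ⁆ ⊆ S
    ⊆S x∈ with x∈p∪q⁻ C ⁅ w ⁆ x∈
    ... | inj₁ x∈C = C⊆S x∈C
    ... | inj₂ x∈w rewrite x∈⁅y⁆⇒x≡y w x∈w = w∈S

    adjacent : ∀ x y → x ∈ C ∪ ⁅ w ⁆ → y ∈ C ∪ ⁅ w ⁆ → x ≢ y → Adj G x y
    adjacent x y x∈ y∈ x≢y with x∈p∪q⁻ C ⁅ w ⁆ x∈ | x∈p∪q⁻ C ⁅ w ⁆ y∈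
    ... | inj₁ x∈C | inj₁ y∈C = clique x y x∈C y∈C x≢y
    ... | inj₁ x∈C | inj₂ y∈w rewrite x∈⁅y⁆⇒x≡y w y∈w = adj-w x∈C x≢y
    ... | inj₂ x∈w | inj₁ y∈C rewrite x∈⁅y⁆⇒x≡y w x∈w = Adj-sym (adj-w y∈C (x≢y ∘ sym))
    ... | inj₂ x∈w | inj₂ y∈w =
      contradiction (trans (x∈⁅y⁆⇒x≡y w x∈w) (sym (x∈⁅y⁆⇒x≡y w y∈w))) x≢y

  simplicial-neighbour∈maximalClique : ∀ {S C v w} → MaximalCliqueIn G S C → v ∈ C →
    SimplicialIn G S v → w ∈ S → Adj G v w → w ∈ C
  simplicial-neighbour∈maximalClique {S} {C} {v} {w}
    (clique@(C⊆S , adjacent) , maximal) v∈C (_ , simplicial) w∈S vw =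
    maximal (C ∪ ⁅ w ⁆) (clique-∪-⁅⁆ clique w∈S adj-w) (p⊆p∪q ⁅ w ⁆) (q⊆p∪q C ⁅ w ⁆ (x∈⁅x⁆ w))
    where
    adj-w : ∀ {x} → x ∈ C → x ≢ w → Adj G x w
    adj-w {x} x∈C x≢w with x ≟ v
    ... | yes refl = vw
    ... | no x≢v = simplicial x w (C⊆S x∈C) w∈S (adjacent v x v∈C x∈C (x≢v ∘ sym)) vw x≢w

  module Cover {k : ℕ} {Vs : Fin k → Subset n} (scc : SuccessiveCliqueCover G Vs) where
    open SuccessiveCliqueCover scc

    part : V G → Fin k
    part x = proj₁ (cover x)

    ∈-part : ∀ x → x ∈ Vs (part x)
    ∈-part x = proj₂ (cover x)

    part-unique : ∀ {x i} → x ∈ Vs i → part x ≡ i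
    part-unique {x} {i} = disjoint x (part x) i (∈-part x)

    remaining : Fin k → Subset n
    remaining i = subsetOf (λ x → i ≤? part x)

    ∈-remaining⁺ : ∀ {i x} → i Fin.≤ part x → x ∈ remaining i
    ∈-remaining⁺ {i} = ∈-subsetOf⁺ (λ x → i ≤? part x)

    ∈-remaining⁻ : ∀ {i x} → x ∈ remaining i → i Fin.≤ part x
    ∈-remaining⁻ {i} = ∈-subsetOf⁻ (λ x → i ≤? part x)

    simplex-remaining : ∀ i → SimplexIn G (remaining i) (Vs i)
    simplex-remaining i = simplex i (remaining i) sound complete
      where
      sound : ∀ x → x ∈ remaining i → Remaining G Vs i x
      sound x x∈ j j<i x∈Vsⱼ =
        <-irrefl refl (<-≤-trans j<i (subst (i Fin.≤_) (part-unique x∈Vsⱼ) (∈-remaining⁻ x∈)))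

      complete : ∀ x → Remaining G Vs i x → x ∈ remaining i
      complete x rem = ∈-remaining⁺ (≮⇒≥ λ part<i → rem (part x) part<i (∈-part x))

    part-maximalClique : ∀ i → MaximalCliqueIn G (remaining i) (Vs i)
    part-maximalClique i = proj₁ (simplex-remaining i)

    simplicial : Fin k → V G
    simplicial i = proj₁ (proj₂ (simplex-remaining i))

    simplicial-∈ : ∀ i → simplicial i ∈ Vs i
    simplicial-∈ i = proj₁ (proj₂ (proj₂ (simplex-remaining i)))

    simplicial-simplicialIn : ∀ i → SimplicialIn G (remaining i) (simplicial i)
    simplicial-simplicialIn i = proj₂ (proj₂ (proj₂ (simplex-remaining i)))

    simplicial-nonadjacent-later : ∀ {i w} → i < part w → ¬ Adj G (simplicial i) w
    simplicial-nonadjacent-later {i} {w} i<part adj = <-irrefl (sym (part-unique w∈Vsᵢ)) i<part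
      where
      w∈Vsᵢ : w ∈ Vs i
      w∈Vsᵢ = simplicial-neighbour∈maximalClique (part-maximalClique i) (simplicial-∈ i)
        (simplicial-simplicialIn i) (∈-remaining⁺ (<⇒≤ i<part)) adj

    independent⇒∣∣≤k : ∀ {J} → Independent G J → ∣ J ∣ ≤ k
    independent⇒∣∣≤k {J} indep =
      ≤-trans (∣p∣≤∣q∣-injection part (λ _ → ∈⊤) same-part⇒≡) (≤-reflexive (∣⊤∣≡n k))
      where
      same-part⇒≡ : ∀ {x y} → x ∈ J → y ∈ J → part x ≡ part y → x ≡ y
      same-part⇒≡ {x} {y} x∈J y∈J e =
        clique∩independent⇒≡ (proj₁ (part-maximalClique (part x))) indep (∈-part x)
          (subst (λ i → y ∈ Vs i) (sym e) (∈-part y)) x∈J y∈J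

    IndependentTransversal : (Fin k → V G) → Set
    IndependentTransversal h = (∀ i → h i ∈ Vs i) × (∀ a b → ¬ Adj G (h a) (h b))

    -- The set {h i | i < k}: since h i ∈ Vs i, a vertex x can only be h (part x).
    image : (Fin k → V G) → Subset n
    image h = subsetOf (λ x → h (part x) ≟ x)

    transversal-∈-image : ∀ {h} → (∀ i → h i ∈ Vs i) → ∀ i → h i ∈ image h
    transversal-∈-image {h} h∈ i = ∈-subsetOf⁺ (λ x → h (part x) ≟ x) (cong h (part-unique (h∈ i)))

    transversal⇒maximumIndependent : ∀ {h} → IndependentTransversal h →
      MaximumIndependent G (image h)
    transversal⇒maximumIndependent {h} (h∈ , nonadj) =
      independent , λ J indep-J → ≤-trans (independent⇒∣∣≤k indep-J) k≤∣image∣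
      where
      ∈-image⁻ : ∀ {x} → x ∈ image h → h (part x) ≡ x
      ∈-image⁻ = ∈-subsetOf⁻ (λ x → h (part x) ≟ x)

      independent : Independent G (image h)
      independent x y x∈ y∈ =
        subst₂ (λ a b → ¬ Adj G a b) (∈-image⁻ x∈) (∈-image⁻ y∈) (nonadj (part x) (part y))

      h-injective : ∀ {a b} → h a ≡ h b → a ≡ b
      h-injective {a} {b} e =
        trans (sym (part-unique (h∈ a))) (trans (cong part e) (part-unique (h∈ b)))

      k≤∣image∣ : k ≤ ∣ image h ∣
      k≤∣image∣ = ≤-trans (≤-reflexive (sym (∣⊤∣≡n k)))
        (∣p∣≤∣q∣-injection {p = ⊤} h (λ {i} _ → transversal-∈-image h∈ i) (λ _ _ → h-injective))

    module Through {i : Fin k} {u : V G} (u∈Vsᵢ : u ∈ Vs i) where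
      later : Fin k → V G
      later = proj₁ (extend i u u∈Vsᵢ)

      later-∈ : ∀ {j} → i < j → later j ∈ Vs j
      later-∈ = proj₁ (proj₂ (extend i u u∈Vsᵢ)) _

      u-nonadjacent-later : ∀ {j} → i < j → ¬ Adj G u (later j)
      u-nonadjacent-later = proj₁ (proj₂ (proj₂ (extend i u u∈Vsᵢ))) _

      later-nonadjacent : ∀ {a b} → i < a → i < b → ¬ Adj G (later a) (later b)
      later-nonadjacent = proj₂ (proj₂ (proj₂ (extend i u u∈Vsᵢ))) _ _

      transversal : Fin k → V G
      transversal j with <-cmp j i
      ... | tri< _ _ _ = simplicial j
      ... | tri≈ _ _ _ = u
      ... | tri> _ _ _ = later j

      transversal-at : transversal i ≡ u
      transversal-at with <-cmp i i
      ... | tri< i<i _ _ = contradiction i<i (<-irrefl refl)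
      ... | tri≈ _ _ _ = refl
      ... | tri> _ _ i<i = contradiction i<i (<-irrefl refl)

      transversal-after : ∀ {j} → i < j → transversal j ≡ later j
      transversal-after {j} i<j with <-cmp j i
      ... | tri< j<i _ _ = contradiction (<-trans i<j j<i) (<-irrefl refl)
      ... | tri≈ _ refl _ = contradiction i<j (<-irrefl refl)
      ... | tri> _ _ _ = refl

      transversal-∈ : ∀ j → transversal j ∈ Vs j
      transversal-∈ j with <-cmp j i
      ... | tri< _ _ _ = simplicial-∈ j
      ... | tri≈ _ refl _ = u∈Vsᵢ
      ... | tri> _ _ i<j = later-∈ i<j

      transversal-nonadjacent : ∀ {a b} → a < b → ¬ Adj G (transversal a) (transversal b)
      transversal-nonadjacent {a} {b} a<b with <-cmp a i
      ... | tri< _ _ _ =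
        simplicial-nonadjacent-later (subst (a <_) (sym (part-unique (transversal-∈ b))) a<b)
      ... | tri≈ _ refl _ rewrite transversal-after a<b = u-nonadjacent-later a<b
      ... | tri> _ _ i<a rewrite transversal-after (<-trans i<a a<b) =
        later-nonadjacent i<a (<-trans i<a a<b)

      transversal-independent : IndependentTransversal transversal
      transversal-independent =
        transversal-∈ , <-nonadjacent⇒nonadjacent transversal transversal-nonadjacent

      u∈image : u ∈ image transversal
      u∈image = subst (_∈ image transversal) transversal-at (transversal-∈-image transversal-∈ i)

proposition4p5 : (G : Graph) → HasSuccessiveCliqueCover G → AlphaExcellent G
proposition4p5 G (k , Vs , scc) v =
  image transversal , transversal⇒maximumIndependent transversal-independent , u∈image
  where
  open Cover G scc
  open Through (∈-part v)
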